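{- Let $q\ge2$, $n\ge0$ be integers and let $G=(g_{ij})_{i,j=0}^{q-1}$ be a $q\times q$ complex matrix whose core is symmetric, with $g_{0,j}=1$ for $j=0,\ldots,q-1$ and $g_{i,0}=-1$ for $i=1,\ldots,q-1$. Then for all $p,s\in V(n,q)$, \[ MG(s;p)=(-1)^{s_0+p_0}\,\frac{p!}{s!}\,MG(p;s). \]
   Context: The core of a $q\times q$ matrix $G=(g_{ij})_{i,j=0}^{q-1}$ is the $(q-1)\times(q-1)$ matrix $(g_{ij})_{i,j=1}^{q-1}$ obtained by deleting the first row and first column. For integers $n\ge0$, $q\ge2$, $V(n,q)=\{p=(p_0,\ldots,p_{q-1})\in\mathbb{N}_0^q : \sum_i p_i=n\}$, and $p!=\prod_{i}p_i!$. For $p,s\in V(n,q)$, \[ MG(p;s)=s!\sum_{(r_{i,j})}\prod_{a=0}^{q-1}\prod_{b=0}^{q-1}\frac{g_{ab}^{r_{a,b}}}{r_{a,b}!}, \] the sum being over all families of nonnegative integers $r_{i,j}$ ($i,j=0,\ldots,q-1$) with $\sum_j r_{i,j}=s_i$ for all $i$ and $\sum_i r_{i,j}=p_j$ for all $j$ (with $0^0=1$). -}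

module Defs where

open import Level using (Level)
open import Algebra.Bundles using (CommutativeRing; Semiring)
open import Data.Nat as ℕ using (ℕ; zero; suc; _∸_; _!)
open import Data.Fin using (Fin)
open import Data.Vec as Vec using (Vec; []; _∷_; lookup)
open import Data.Vec.Properties using (≡-dec)
open import Data.List as List using (List; concatMap; upTo; filter; [_])
import Algebra.Definitions.RawSemiring as RS

comps : (k n : ℕ) → List (Vec ℕ k)
comps zero zero = [ [] ]
comps zero (suc n) = List.[]
comps (suc k) n = concatMap (λ i → List.map (i ∷_) (comps k (n ∸ i))) (upTo (suc n))

-- all k×q matrices (as vectors of rows) of naturals whose a-th row sums to s_a
rowChoices : ∀ {q k} → Vec ℕ k → List (Vec (Vec ℕ q) k)
rowChoices [] = [ [] ]
rowChoices {q} (x ∷ xs) = concatMap (λ row → List.map (row ∷_) (rowChoices xs)) (comps q x)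

colSums : ∀ {q k} → Vec (Vec ℕ q) k → Vec ℕ q
colSums {q} = Vec.foldr _ (Vec.zipWith ℕ._+_) (Vec.replicate q 0)

-- all families (r_{ij}) with row sums s_i and column sums p_j
families : ∀ {q} → (p s : Vec ℕ q) → List (Vec (Vec ℕ q) q)
families p s = filter (λ r → ≡-dec ℕ._≟_ (colSums r) p) (rowChoices s)

vfact : ∀ {q} → Vec ℕ q → ℕ
vfact p = Vec.foldr _ ℕ._*_ 1 (Vec.map _! p)

-- the 0-th entry (used only for q ≥ 1)
first : ∀ {q} → Vec ℕ q → ℕ
first [] = 0
first (x ∷ _) = x

module Ops {c ℓ : Level} (R : CommutativeRing c ℓ) (inv : CommutativeRing.Carrier R → CommutativeRing.Carrier R) where
  open CommutativeRing R
  open RS (Semiring.rawSemiring semiring) using (_×_; _^_)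

  pow : Carrier → ℕ → Carrier
  pow = _^_

  ι : ℕ → Carrier
  ι n = n × 1#

  ∑L : List Carrier → Carrier
  ∑L = List.foldr _+_ 0#

  ∏F : ∀ {q} → (Fin q → Carrier) → Carrier
  ∏F {q} f = Vec.foldr _ _*_ 1# (Vec.tabulate {n = q} f)

  -- MG(p;s) = s! Σ_{(r_ij)} ∏_a ∏_b g_ab^{r_ab} / r_ab!
  MG : ∀ {q} → (Fin q → Fin q → Carrier) → (p s : Vec ℕ q) → Carrier
  MG g p s = ι (vfact s) * ∑L (List.map
    (λ r → ∏F (λ a → ∏F (λ b → (g a b ^ lookup (lookup r a) b) * inv (ι (lookup (lookup r a) b !)))))
    (families p s))

module Submission where

-- Write rᵀ for the transpose of a family r = (r_ab).  Transposition maps the families with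
-- row sums p and column sums s bijectively onto those with row sums s and column sums p, so
-- the sum defining MG(s;p) may be re-indexed by rᵀ, r ranging over the families of MG(p;s).
-- The hypotheses on G say precisely that g_ba = (-1)^crossing(a,b) g_ab, where crossing(a,b) = 1 iff exactly
-- one of a, b is 0.  Hence the weight ∏ g_ab^(r_ab)/r_ab! of rᵀ is that of r times
-- (-1)^(Σ_{b≠0} r_0b + Σ_{a≠0} r_a0), and this sign equals (-1)^(s₀+p₀) because s₀ and p₀
-- exceed the two partial sums by r_00 each.  So MG(s;p) = p! (-1)^(s₀+p₀) Σ_r w(r), and
-- cancelling the non-zero natural number s! against its inverse gives the theorem.

open import Defs
open import Level using (Level)
open import Algebra.Bundles using (CommutativeRing)
open import Data.Nat as ℕ using (ℕ; zero; suc; _≤_; _∸_; _!; s≤s; NonZero)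
import Data.Nat.Properties as ℕP
open import Data.Fin using (Fin; toℕ) renaming (zero to fzero; suc to fsuc)
open import Data.Vec as Vec using (Vec; []; _∷_; lookup; tabulate; sum)
import Data.Vec.Properties as VecP
open import Data.List as List using (List; concatMap; upTo)
import Data.List.Properties as ListP
open import Data.List.Membership.Propositional using (_∈_)
open import Data.List.Membership.Propositional.Properties
open import Data.List.Membership.Propositional.Properties.WithK using (unique∧set⇒bag)
open import Data.List.Relation.Unary.Any using (here; there)
open import Data.List.Relation.Unary.All as All using ()
open import Data.List.Relation.Unary.AllPairs using ([]; _∷_)
open import Data.List.Relation.Unary.Unique.Propositional using (Unique)
import Data.List.Relation.Unary.Unique.Propositional.Properties as Unique
open import Data.List.Relation.Binary.Permutation.Propositional using (_↭_; ↭⇒↭ₛ′)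
open import Data.List.Relation.Binary.Permutation.Propositional.Properties using (map⁺)
import Data.List.Relation.Binary.Permutation.Setoid.Properties as PermSetoid
open import Data.List.Relation.Binary.BagAndSetEquality using (∼bag⇒↭)
open import Data.Product using (_×_; _,_; proj₁)
open import Data.Sum using (inj₁; inj₂)
open import Function using (_∘_)
open import Function.Bundles using (mk⇔)
open import Relation.Binary.PropositionalEquality as ≡ using (_≡_)
open import Relation.Nullary using (¬_)

module Combinatorics where
  open ≡ using (refl; sym; trans; cong; cong₂; subst)

  module _ {a} {A : Set a} {k : ℕ} where

    -- The dependent product of a list xs with lists L x: all vectors x ∷ v, x ∈ xs, v ∈ L x.
    -- Both comps and rowChoices are built by this construction.
    extend : (A → List (Vec A k)) → List A → List (Vec A (suc k))
    extend L xs = concatMap (λ x → List.map (x ∷_) (L x)) xs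

    ∈-extend⁺ : ∀ L xs {x v} → x ∈ xs → v ∈ L x → (x ∷ v) ∈ extend L xs
    ∈-extend⁺ L (y List.∷ xs) (here refl) v∈ = ∈-++⁺ˡ (∈-map⁺ (y ∷_) v∈)
    ∈-extend⁺ L (y List.∷ xs) (there x∈) v∈ = ∈-++⁺ʳ (List.map (y ∷_) (L y)) (∈-extend⁺ L xs x∈ v∈)

    ∈-extend⁻ : ∀ L xs {x v} → (x ∷ v) ∈ extend L xs → x ∈ xs × v ∈ L x
    ∈-extend⁻ L (y List.∷ xs) m with ∈-++⁻ (List.map (y ∷_) (L y)) m
    ... | inj₁ m′ with ∈-map⁻ (y ∷_) m′
    ...   | w , w∈ , refl = here refl , w∈
    ∈-extend⁻ L (y List.∷ xs) m | inj₂ m′ with ∈-extend⁻ L xs m′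
    ... | x∈ , v∈ = there x∈ , v∈

    extend-unique : ∀ L xs → Unique xs → (∀ x → Unique (L x)) → Unique (extend L xs)
    extend-unique L List.[] _ _ = []
    extend-unique L (y List.∷ xs) (y∉ ∷ u) uL =
      Unique.++⁺ (Unique.map⁺ VecP.∷-injectiveʳ (uL y)) (extend-unique L xs u uL) disjoint
      where
      disjoint : ∀ {v} → ¬ (v ∈ List.map (y ∷_) (L y) × v ∈ extend L xs)
      disjoint {x ∷ _} (m₁ , m₂) with ∈-map⁻ (y ∷_) m₁
      ... | _ , _ , refl = All.lookup y∉ (proj₁ (∈-extend⁻ L xs m₂)) refl

  ∈-comps⁻ : ∀ k n (v : Vec ℕ k) → v ∈ comps k n → sum v ≡ n
  ∈-comps⁻ zero zero [] _ = refl
  ∈-comps⁻ (suc k) n (x ∷ v) m with ∈-extend⁻ (λ i → comps k (n ∸ i)) (upTo (suc n)) m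
  ... | x∈ , v∈ = trans (cong (x ℕ.+_) (∈-comps⁻ k (n ∸ x) v v∈))
                    (ℕP.m+[n∸m]≡n (ℕ.s≤s⁻¹ (∈-upTo⁻ x∈)))

  ∈-comps⁺ : ∀ k n (v : Vec ℕ k) → sum v ≡ n → v ∈ comps k n
  ∈-comps⁺ zero zero [] _ = here refl
  ∈-comps⁺ (suc k) n (x ∷ v) refl =
    ∈-extend⁺ (λ i → comps k (n ∸ i)) (upTo (suc n))
      (∈-upTo⁺ (s≤s (ℕP.m≤m+n x (sum v))))
      (∈-comps⁺ k (n ∸ x) v (sym (ℕP.m+n∸m≡n x (sum v))))

  comps-unique : ∀ k n → Unique (comps k n)
  comps-unique zero zero = All.[] ∷ []
  comps-unique zero (suc n) = []
  comps-unique (suc k) n =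
    extend-unique (λ i → comps k (n ∸ i)) (upTo (suc n)) (Unique.upTo⁺ (suc n)) (λ i → comps-unique k (n ∸ i))

  rowSums : ∀ {q k} → Vec (Vec ℕ q) k → Vec ℕ k
  rowSums = Vec.map sum

  ∈-rowChoices⁻ : ∀ {q k} (s : Vec ℕ k) (r : Vec (Vec ℕ q) k) → r ∈ rowChoices s → rowSums r ≡ s
  ∈-rowChoices⁻ [] [] _ = refl
  ∈-rowChoices⁻ {q} (x ∷ s) (row ∷ r) m with ∈-extend⁻ (λ _ → rowChoices s) (comps q x) m
  ... | row∈ , r∈ = cong₂ _∷_ (∈-comps⁻ q x row row∈) (∈-rowChoices⁻ s r r∈)

  ∈-rowChoices⁺ : ∀ {q k} (s : Vec ℕ k) (r : Vec (Vec ℕ q) k) → rowSums r ≡ s → r ∈ rowChoices s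
  ∈-rowChoices⁺ [] [] _ = here refl
  ∈-rowChoices⁺ {q} (x ∷ s) (row ∷ r) refl =
    ∈-extend⁺ (λ _ → rowChoices s) (comps q x) (∈-comps⁺ q x row refl) (∈-rowChoices⁺ s r refl)

  rowChoices-unique : ∀ {q k} (s : Vec ℕ k) → Unique (rowChoices {q} s)
  rowChoices-unique [] = All.[] ∷ []
  rowChoices-unique {q} (x ∷ s) =
    extend-unique (λ _ → rowChoices s) (comps q x) (comps-unique q x) (λ _ → rowChoices-unique s)

  ∈-families⁻ : ∀ {q} (p s : Vec ℕ q) {r} → r ∈ families p s → rowSums r ≡ s × colSums r ≡ p
  ∈-families⁻ p s {r} m with ∈-filter⁻ (λ r → VecP.≡-dec ℕ._≟_ (colSums r) p) m
  ... | r∈ , cols = ∈-rowChoices⁻ s r r∈ , cols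

  ∈-families⁺ : ∀ {q} (p s : Vec ℕ q) {r} → rowSums r ≡ s → colSums r ≡ p → r ∈ families p s
  ∈-families⁺ p s {r} rows cols =
    ∈-filter⁺ (λ r → VecP.≡-dec ℕ._≟_ (colSums r) p) (∈-rowChoices⁺ s r rows) cols

  families-unique : ∀ {q} (p s : Vec ℕ q) → Unique (families p s)
  families-unique p s = Unique.filter⁺ (λ r → VecP.≡-dec ℕ._≟_ (colSums r) p) (rowChoices-unique s)

  -- Sum of a function on Fin q; it unfolds definitionally as f 0 + ∑ℕ (f ∘ suc).
  ∑ℕ : ∀ {q} → (Fin q → ℕ) → ℕ
  ∑ℕ f = sum (tabulate f)

  ∑ℕ-cong : ∀ {q} {f g : Fin q → ℕ} → (∀ i → f i ≡ g i) → ∑ℕ f ≡ ∑ℕ g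
  ∑ℕ-cong f≡g = cong sum (VecP.tabulate-cong f≡g)

  ∑ℕ-zero : ∀ {q} → ∑ℕ {q} (λ _ → 0) ≡ 0
  ∑ℕ-zero {zero} = refl
  ∑ℕ-zero {suc q} = ∑ℕ-zero {q}

  lookup-ext : ∀ {a} {A : Set a} {n} {v w : Vec A n} → (∀ i → lookup v i ≡ lookup w i) → v ≡ w
  lookup-ext {v = v} {w} f =
    trans (sym (VecP.tabulate∘lookup v)) (trans (VecP.tabulate-cong f) (VecP.tabulate∘lookup w))

  entry : ∀ {q k} → Vec (Vec ℕ q) k → Fin k → Fin q → ℕ
  entry r a b = lookup (lookup r a) b

  transpose : ∀ {q} → Vec (Vec ℕ q) q → Vec (Vec ℕ q) q
  transpose r = tabulate (λ j → tabulate (λ i → entry r i j))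

  entry-transpose : ∀ {q} (r : Vec (Vec ℕ q) q) a b → entry (transpose r) a b ≡ entry r b a
  entry-transpose r a b = trans (cong (λ v → lookup v b) (VecP.lookup∘tabulate _ a)) (VecP.lookup∘tabulate _ b)

  transpose-involutive : ∀ {q} (r : Vec (Vec ℕ q) q) → transpose (transpose r) ≡ r
  transpose-involutive r =
    lookup-ext (λ i → lookup-ext (λ j → trans (entry-transpose (transpose r) i j) (entry-transpose r j i)))

  rowSum-lookup : ∀ {q k} (m : Vec (Vec ℕ q) k) a → lookup (rowSums m) a ≡ ∑ℕ (entry m a)
  rowSum-lookup m a = trans (VecP.lookup-map a sum m) (cong sum (sym (VecP.tabulate∘lookup (lookup m a))))

  colSum-lookup : ∀ {q k} (m : Vec (Vec ℕ q) k) b → lookup (colSums m) b ≡ ∑ℕ (λ a → entry m a b)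
  colSum-lookup [] b = VecP.lookup-replicate b 0
  colSum-lookup (row ∷ m) b =
    trans (VecP.lookup-zipWith ℕ._+_ b row (colSums m)) (cong (lookup row b ℕ.+_) (colSum-lookup m b))

  rowSums-transpose : ∀ {q} (r : Vec (Vec ℕ q) q) → rowSums (transpose r) ≡ colSums r
  rowSums-transpose r = lookup-ext λ j → trans (rowSum-lookup (transpose r) j)
    (trans (cong sum (VecP.tabulate-cong (entry-transpose r j))) (sym (colSum-lookup r j)))

  colSums-transpose : ∀ {q} (r : Vec (Vec ℕ q) q) → colSums (transpose r) ≡ rowSums r
  colSums-transpose r = lookup-ext λ j → trans (colSum-lookup (transpose r) j)
    (trans (cong sum (VecP.tabulate-cong (λ i → entry-transpose r i j))) (sym (rowSum-lookup r j)))

  -- Transposition is a bijection families p s → families s p; as both lists are duplicate-free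
  -- this makes families s p a permutation of the transposed families p s.
  families-transpose : ∀ {q} (p s : Vec ℕ q) → families s p ↭ List.map transpose (families p s)
  families-transpose p s = ∼bag⇒↭ (unique∧set⇒bag (families-unique s p)
      (Unique.map⁺ transpose-injective (families-unique p s)) (mk⇔ to from))
    where
    transpose-injective : ∀ {x y} → transpose x ≡ transpose y → x ≡ y
    transpose-injective {x} {y} e =
      trans (sym (transpose-involutive x)) (trans (cong transpose e) (transpose-involutive y))
    to : ∀ {r} → r ∈ families s p → r ∈ List.map transpose (families p s)
    to {r} m with ∈-families⁻ s p m
    ... | rows , cols = subst (_∈ List.map transpose (families p s)) (transpose-involutive r)
          (∈-map⁺ transpose (∈-families⁺ p s (trans (rowSums-transpose r) cols) (trans (colSums-transpose r) rows)))
    from : ∀ {r} → r ∈ List.map transpose (families p s) → r ∈ families s p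
    from m with ∈-map⁻ transpose m
    ... | r′ , m′ , refl with ∈-families⁻ p s m′
    ... | rows , cols = ∈-families⁺ s p (trans (rowSums-transpose r′) cols) (trans (colSums-transpose r′) rows)

  -- crossing a b = 1 iff exactly one of a, b is the index 0; it is the exponent of the sign
  -- relating g_ba to g_ab.
  crossing : ∀ {q} → Fin (suc q) → Fin (suc q) → ℕ
  crossing fzero fzero = 0
  crossing fzero (fsuc _) = 1
  crossing (fsuc _) fzero = 1
  crossing (fsuc _) (fsuc _) = 0

  crossing-sum : ∀ {q} (e : Fin (suc q) → Fin (suc q) → ℕ) →
    ∑ℕ (λ a → ∑ℕ (λ b → crossing a b ℕ.* e a b)) ≡ ∑ℕ (λ b → e fzero (fsuc b)) ℕ.+ ∑ℕ (λ a → e (fsuc a) fzero)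
  crossing-sum {q} e = cong₂ ℕ._+_ (∑ℕ-cong (λ b → ℕP.+-identityʳ (e fzero (fsuc b))))
    (trans (∑ℕ-cong (λ a → cong₂ ℕ._+_ (ℕP.+-identityʳ (e (fsuc a) fzero)) (∑ℕ-zero {q})))
           (∑ℕ-cong (λ a → ℕP.+-identityʳ (e (fsuc a) fzero))))

  first≡lookup : ∀ {q} (v : Vec ℕ (suc q)) → first v ≡ lookup v fzero
  first≡lookup (_ ∷ _) = refl

  first-rowSums : ∀ {q k} (r : Vec (Vec ℕ (suc q)) (suc k)) →
    first (rowSums r) ≡ entry r fzero fzero ℕ.+ ∑ℕ (λ b → entry r fzero (fsuc b))
  first-rowSums r = trans (first≡lookup (rowSums r)) (rowSum-lookup r fzero)

  first-colSums : ∀ {q k} (r : Vec (Vec ℕ (suc q)) (suc k)) →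
    first (colSums r) ≡ entry r fzero fzero ℕ.+ ∑ℕ (λ a → entry r (fsuc a) fzero)
  first-colSums r = trans (first≡lookup (colSums r)) (colSum-lookup r fzero)

  vfact-nonZero : ∀ {q} (v : Vec ℕ q) → NonZero (vfact v)
  vfact-nonZero [] = _
  vfact-nonZero (x ∷ v) = ℕP.m*n≢0 (x !) (vfact v) {{ℕP._!≢0 x}} {{vfact-nonZero v}}

open Combinatorics

module Weights {c ℓ : Level} (R : CommutativeRing c ℓ) (inv : CommutativeRing.Carrier R → CommutativeRing.Carrier R) where
  open CommutativeRing R
  open Ops R inv
  open import Relation.Binary.Reasoning.Setoid setoid
  open import Algebra.Properties.Semiring.Exp semiring using (^-congˡ; ^-homo-*; ^-assocʳ)
  open import Algebra.Properties.CommutativeSemiring.Exp commutativeSemiring using (^-distrib-*)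
  open import Algebra.Properties.Ring ring using (-1*x≈-x; -‿involutive)
  import Algebra.Properties.CommutativeMonoid.Sum *-commutativeMonoid as Product

  ∑L-↭ : ∀ {A : Set} (f : A → Carrier) {xs ys} → xs ↭ ys → ∑L (List.map f xs) ≈ ∑L (List.map f ys)
  ∑L-↭ f perm = PermSetoid.foldr-commMonoid setoid +-isCommutativeMonoid (↭⇒↭ₛ′ isEquivalence (map⁺ f perm))

  ∑L-cong : ∀ {A : Set} {f g : A → Carrier} (xs : List A) → (∀ {x} → x ∈ xs → f x ≈ g x) →
    ∑L (List.map f xs) ≈ ∑L (List.map g xs)
  ∑L-cong List.[] _ = refl
  ∑L-cong (x List.∷ xs) f≈g = +-cong (f≈g (here ≡.refl)) (∑L-cong xs (f≈g ∘ there))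

  ∑L-*ˡ : ∀ {A : Set} (k : Carrier) (f : A → Carrier) (xs : List A) →
    ∑L (List.map (λ x → k * f x) xs) ≈ k * ∑L (List.map f xs)
  ∑L-*ˡ k f List.[] = sym (zeroʳ k)
  ∑L-*ˡ k f (x List.∷ xs) = trans (+-congˡ (∑L-*ˡ k f xs)) (sym (distribˡ k _ _))

  ∏F≡product : ∀ {q} (f : Fin q → Carrier) → ∏F f ≡ Product.sum f
  ∏F≡product {zero} f = ≡.refl
  ∏F≡product {suc q} f = ≡.cong (f fzero *_) (∏F≡product (f ∘ fsuc))

  ∏F-cong : ∀ {q} {f g : Fin q → Carrier} → (∀ i → f i ≈ g i) → ∏F f ≈ ∏F g
  ∏F-cong {zero} _ = refl
  ∏F-cong {suc q} f≈g = *-cong (f≈g fzero) (∏F-cong (f≈g ∘ fsuc))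

  ∏F-distrib : ∀ {q} (f g : Fin q → Carrier) → ∏F (λ i → f i * g i) ≈ ∏F f * ∏F g
  ∏F-distrib f g = begin
    ∏F (λ i → f i * g i)  ≡⟨ ∏F≡product (λ i → f i * g i) ⟩
    Product.sum (λ i → f i * g i)  ≈⟨ Product.∑-distrib-+ f g ⟩
    Product.sum f * Product.sum g  ≡⟨ ≡.sym (≡.cong₂ _*_ (∏F≡product f) (∏F≡product g)) ⟩
    ∏F f * ∏F g  ∎

  ∏F-comm : ∀ {m n} (h : Fin m → Fin n → Carrier) →
    ∏F (λ a → ∏F (λ b → h a b)) ≈ ∏F (λ b → ∏F (λ a → h a b))
  ∏F-comm h = begin
    ∏F (λ a → ∏F (h a))  ≡⟨ double h ⟩
    Product.sum (λ a → Product.sum (h a))  ≈⟨ Product.∑-comm h ⟩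
    Product.sum (λ b → Product.sum (λ a → h a b))  ≡⟨ ≡.sym (double (λ b a → h a b)) ⟩
    ∏F (λ b → ∏F (λ a → h a b))  ∎
    where
    double : ∀ {m n} (h : Fin m → Fin n → Carrier) →
      ∏F (λ a → ∏F (h a)) ≡ Product.sum (λ a → Product.sum (h a))
    double h = ≡.trans (∏F≡product (λ a → ∏F (h a))) (Product.sum-cong-≗ (λ a → ∏F≡product (h a)))

  ∏F-pow : ∀ {q} (x : Carrier) (d : Fin q → ℕ) → ∏F (λ i → pow x (d i)) ≈ pow x (∑ℕ d)
  ∏F-pow {zero} x d = refl
  ∏F-pow {suc q} x d = trans (*-congˡ (∏F-pow x (d ∘ fsuc))) (sym (^-homo-* x (d fzero) (∑ℕ (d ∘ fsuc))))

  ∏F-pow-* : ∀ {q} (x : Carrier) (d : Fin q → ℕ) (f : Fin q → Carrier) →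
    ∏F (λ i → pow x (d i) * f i) ≈ pow x (∑ℕ d) * ∏F f
  ∏F-pow-* x d f = trans (∏F-distrib (λ i → pow x (d i)) f) (*-congʳ (∏F-pow x d))

  minus-one-squared : - 1# * - 1# ≈ 1#
  minus-one-squared = trans (-1*x≈-x (- 1#)) (-‿involutive 1#)

  pow-one : ∀ k → pow 1# k ≈ 1#
  pow-one zero = refl
  pow-one (suc k) = trans (*-identityˡ _) (pow-one k)

  sign-parity : ∀ c a b → pow (- 1#) ((c ℕ.+ a) ℕ.+ (c ℕ.+ b)) ≈ pow (- 1#) (a ℕ.+ b)
  sign-parity c a b = begin
    pow (- 1#) ((c ℕ.+ a) ℕ.+ (c ℕ.+ b))  ≡⟨ ≡.cong (pow (- 1#)) (exponent c a b) ⟩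
    pow (- 1#) ((a ℕ.+ b) ℕ.+ 2 ℕ.* c)  ≈⟨ ^-homo-* (- 1#) (a ℕ.+ b) (2 ℕ.* c) ⟩
    pow (- 1#) (a ℕ.+ b) * pow (- 1#) (2 ℕ.* c)  ≈⟨ *-congˡ (sym (^-assocʳ (- 1#) 2 c)) ⟩
    pow (- 1#) (a ℕ.+ b) * pow (- 1# * (- 1# * 1#)) c  ≈⟨ *-congˡ (^-congˡ c (trans (*-congˡ (*-identityʳ (- 1#))) minus-one-squared)) ⟩
    pow (- 1#) (a ℕ.+ b) * pow 1# c  ≈⟨ *-congˡ (pow-one c) ⟩
    pow (- 1#) (a ℕ.+ b) * 1#  ≈⟨ *-identityʳ _ ⟩
    pow (- 1#) (a ℕ.+ b)  ∎
    where
    open import Data.Nat.Tactic.RingSolver using (solve-∀)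
    exponent : ∀ c a b → (c ℕ.+ a) ℕ.+ (c ℕ.+ b) ≡ (a ℕ.+ b) ℕ.+ 2 ℕ.* c
    exponent = solve-∀

  term : Carrier → ℕ → Carrier
  term g k = pow g k * inv (ι (k !))

  -- The weight ∏_a ∏_b g_ab^(e_ab) / e_ab! of an exponent matrix e; MG g p s is s! times
  -- the sum of weight g (entry r) over r ∈ families p s.
  weight : ∀ {q} → (Fin q → Fin q → Carrier) → (Fin q → Fin q → ℕ) → Carrier
  weight g e = ∏F (λ a → ∏F (λ b → term (g a b) (e a b)))

  weight-cong : ∀ {q} (g : Fin q → Fin q → Carrier) {e e′ : Fin q → Fin q → ℕ} →
    (∀ a b → e a b ≡ e′ a b) → weight g e ≈ weight g e′
  weight-cong g e≡e′ = ∏F-cong (λ a → ∏F-cong (λ b → reflexive (≡.cong (term (g a b)) (e≡e′ a b))))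

  weight-transpose : ∀ {q} (g : Fin q → Fin q → Carrier) (e : Fin q → Fin q → ℕ) →
    weight g (λ a b → e b a) ≈ weight (λ a b → g b a) e
  weight-transpose g e = ∏F-comm (λ a b → term (g a b) (e b a))

  term-sign : ∀ g h d k → g ≈ pow (- 1#) d * h → term g k ≈ pow (- 1#) (d ℕ.* k) * term h k
  term-sign g h d k g≈ = begin
    pow g k * inv (ι (k !))  ≈⟨ *-congʳ (^-congˡ k g≈) ⟩
    pow (pow (- 1#) d * h) k * inv (ι (k !))  ≈⟨ *-congʳ (^-distrib-* _ h k) ⟩
    (pow (pow (- 1#) d) k * pow h k) * inv (ι (k !))  ≈⟨ *-assoc _ _ _ ⟩
    pow (pow (- 1#) d) k * term h k  ≈⟨ *-congʳ (^-assocʳ (- 1#) d k) ⟩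
    pow (- 1#) (d ℕ.* k) * term h k  ∎

  weight-sign : ∀ {q} (g h : Fin q → Fin q → Carrier) (d e : Fin q → Fin q → ℕ) →
    (∀ a b → g a b ≈ pow (- 1#) (d a b) * h a b) →
    weight g e ≈ pow (- 1#) (∑ℕ (λ a → ∑ℕ (λ b → d a b ℕ.* e a b))) * weight h e
  weight-sign g h d e g≈ = begin
    weight g e  ≈⟨ ∏F-cong (λ a → ∏F-cong (λ b → term-sign (g a b) (h a b) (d a b) (e a b) (g≈ a b))) ⟩
    ∏F (λ a → ∏F (λ b → pow (- 1#) (d a b ℕ.* e a b) * term (h a b) (e a b)))
      ≈⟨ ∏F-cong (λ a → ∏F-pow-* (- 1#) (λ b → d a b ℕ.* e a b) (λ b → term (h a b) (e a b))) ⟩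
    ∏F (λ a → pow (- 1#) (∑ℕ (λ b → d a b ℕ.* e a b)) * ∏F (λ b → term (h a b) (e a b)))
      ≈⟨ ∏F-pow-* (- 1#) (λ a → ∑ℕ (λ b → d a b ℕ.* e a b)) (λ a → ∏F (λ b → term (h a b) (e a b))) ⟩
    pow (- 1#) (∑ℕ (λ a → ∑ℕ (λ b → d a b ℕ.* e a b))) * weight h e  ∎

  crossing-sign : ∀ {q} (G : Fin (suc q) → Fin (suc q) → Carrier) →
    (∀ i j → 1 ≤ toℕ i → 1 ≤ toℕ j → G i j ≈ G j i) →
    (∀ i j → toℕ i ≡ 0 → G i j ≈ 1#) →
    (∀ i j → 1 ≤ toℕ i → toℕ j ≡ 0 → G i j ≈ - 1#) →
    ∀ a b → G b a ≈ pow (- 1#) (crossing a b) * G a b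
  crossing-sign G symmetric row₀ col₀ fzero fzero = sym (*-identityˡ _)
  crossing-sign G symmetric row₀ col₀ fzero (fsuc b) = begin
    G (fsuc b) fzero  ≈⟨ col₀ (fsuc b) fzero (s≤s ℕ.z≤n) ≡.refl ⟩
    - 1#  ≈⟨ sym (*-identityʳ _) ⟩
    - 1# * 1#  ≈⟨ sym (*-identityʳ _) ⟩
    (- 1# * 1#) * 1#  ≈⟨ *-congˡ (sym (row₀ fzero (fsuc b) ≡.refl)) ⟩
    (- 1# * 1#) * G fzero (fsuc b)  ∎
  crossing-sign G symmetric row₀ col₀ (fsuc a) fzero = begin
    G fzero (fsuc a)  ≈⟨ row₀ fzero (fsuc a) ≡.refl ⟩
    1#  ≈⟨ sym minus-one-squared ⟩
    - 1# * - 1#  ≈⟨ *-cong (sym (*-identityʳ _)) (sym (col₀ (fsuc a) fzero (s≤s ℕ.z≤n) ≡.refl)) ⟩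
    (- 1# * 1#) * G (fsuc a) fzero  ∎
  crossing-sign G symmetric row₀ col₀ (fsuc a) (fsuc b) =
    trans (symmetric (fsuc b) (fsuc a) (s≤s ℕ.z≤n) (s≤s ℕ.z≤n)) (sym (*-identityˡ _))

  weight-transpose-sign : ∀ {q} (G : Fin (suc q) → Fin (suc q) → Carrier) →
    (∀ a b → G b a ≈ pow (- 1#) (crossing a b) * G a b) →
    ∀ r → weight G (entry (transpose r)) ≈ pow (- 1#) (first (rowSums r) ℕ.+ first (colSums r)) * weight G (entry r)
  weight-transpose-sign G G-sign r = begin
    weight G (entry (transpose r))  ≈⟨ weight-cong G (entry-transpose r) ⟩
    weight G (λ a b → e b a)  ≈⟨ weight-transpose G e ⟩
    weight (λ a b → G b a) e  ≈⟨ weight-sign (λ a b → G b a) G crossing e G-sign ⟩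
    pow (- 1#) (∑ℕ (λ a → ∑ℕ (λ b → crossing a b ℕ.* e a b))) * weight G e  ≡⟨ ≡.cong (λ k → pow (- 1#) k * weight G e) (crossing-sum e) ⟩
    pow (- 1#) (rest₀ ℕ.+ rest₀′) * weight G e  ≈⟨ *-congʳ (sym (sign-parity (e fzero fzero) rest₀ rest₀′)) ⟩
    pow (- 1#) ((e fzero fzero ℕ.+ rest₀) ℕ.+ (e fzero fzero ℕ.+ rest₀′)) * weight G e
      ≡⟨ ≡.cong (λ k → pow (- 1#) k * weight G e) (≡.sym (≡.cong₂ ℕ._+_ (first-rowSums r) (first-colSums r))) ⟩
    pow (- 1#) (first (rowSums r) ℕ.+ first (colSums r)) * weight G e  ∎
    where
    e : Fin (suc _) → Fin (suc _) → ℕ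
    e = entry r
    rest₀ rest₀′ : ℕ
    rest₀ = ∑ℕ (λ b → e fzero (fsuc b))
    rest₀′ = ∑ℕ (λ a → e (fsuc a) fzero)

  MG-transpose : ∀ {q} (G : Fin (suc q) → Fin (suc q) → Carrier) →
    (∀ a b → G b a ≈ pow (- 1#) (crossing a b) * G a b) →
    ∀ p s → MG G s p ≈ ι (vfact p) * (pow (- 1#) (first s ℕ.+ first p) * ∑L (List.map (weight G ∘ entry) (families p s)))
  MG-transpose G G-sign p s = *-congˡ (begin
    ∑L (List.map w (families s p))  ≈⟨ ∑L-↭ w (families-transpose p s) ⟩
    ∑L (List.map w (List.map transpose (families p s)))  ≡⟨ ≡.cong ∑L (≡.sym (ListP.map-∘ (families p s))) ⟩
    ∑L (List.map (w ∘ transpose) (families p s))  ≈⟨ ∑L-cong (families p s) sign ⟩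
    ∑L (List.map (λ r → σ * w r) (families p s))  ≈⟨ ∑L-*ˡ σ w (families p s) ⟩
    σ * ∑L (List.map w (families p s))  ∎)
    where
    w : Vec (Vec ℕ (suc _)) (suc _) → Carrier
    w = weight G ∘ entry
    σ : Carrier
    σ = pow (- 1#) (first s ℕ.+ first p)
    sign : ∀ {r} → r ∈ families p s → w (transpose r) ≈ σ * w r
    sign {r} r∈ with ∈-families⁻ p s r∈
    ... | ≡.refl , ≡.refl = weight-transpose-sign G G-sign r

  cancel : ∀ {z} → z * inv z ≈ 1# → ∀ x y → (x * inv z) * (z * y) ≈ x * y
  cancel {z} z⁻¹ x y = begin
    (x * inv z) * (z * y)  ≈⟨ *-assoc x (inv z) (z * y) ⟩
    x * (inv z * (z * y))  ≈⟨ *-congˡ (sym (*-assoc (inv z) z y)) ⟩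
    x * ((inv z * z) * y)  ≈⟨ *-congˡ (*-congʳ (trans (*-comm (inv z) z) z⁻¹)) ⟩
    x * (1# * y)  ≈⟨ *-congˡ (*-identityˡ y) ⟩
    x * y  ∎

  ι-nonZero : (∀ m → ¬ (ι (suc m) ≈ 0#)) → ∀ n .{{_ : NonZero n}} → ¬ (ι n ≈ 0#)
  ι-nonZero ι-suc n = ≡.subst (λ k → ¬ (ι k ≈ 0#)) (ℕP.suc-pred n) (ι-suc (ℕ.pred n))

mainTheorem4 : ∀ {c ℓ} (R : CommutativeRing c ℓ)
    (inv : CommutativeRing.Carrier R → CommutativeRing.Carrier R) →
    let open CommutativeRing R
        open Ops R inv
    in (∀ x → ¬ (x ≈ 0#) → x * inv x ≈ 1#) →
       (∀ m → ¬ (ι (suc m) ≈ 0#)) →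
       (q n : ℕ) → 2 ≤ q →
       (G : Fin q → Fin q → Carrier) →
       (∀ i j → 1 ≤ toℕ i → 1 ≤ toℕ j → G i j ≈ G j i) →
       (∀ i j → toℕ i ≡ 0 → G i j ≈ 1#) →
       (∀ i j → 1 ≤ toℕ i → toℕ j ≡ 0 → G i j ≈ - 1#) →
       (p s : Vec ℕ q) → sum p ≡ n → sum s ≡ n →
       MG G s p ≈ (pow (- 1#) (first s ℕ.+ first p) * (ι (vfact p) * inv (ι (vfact s)))) * MG G p s
mainTheorem4 R inv inverse ι-suc (suc q) n _ G symmetric row₀ col₀ p s _ _ = begin
    MG G s p  ≈⟨ MG-transpose G (crossing-sign G symmetric row₀ col₀) p s ⟩
    ι (vfact p) * (σ * S)  ≈⟨ x∙yz≈yx∙z (ι (vfact p)) σ S ⟩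
    (σ * ι (vfact p)) * S  ≈⟨ sym (cancel (inverse (ι (vfact s)) s!≉0) (σ * ι (vfact p)) S) ⟩
    ((σ * ι (vfact p)) * inv (ι (vfact s))) * (ι (vfact s) * S)  ≈⟨ *-congʳ (*-assoc σ _ _) ⟩
    (σ * (ι (vfact p) * inv (ι (vfact s)))) * MG G p s  ∎
  where
  open CommutativeRing R
  open Ops R inv
  open Weights R inv
  open import Relation.Binary.Reasoning.Setoid setoid
  open import Algebra.Properties.CommutativeSemigroup *-commutativeSemigroup using (x∙yz≈yx∙z)
  σ : Carrier
  σ = pow (- 1#) (first s ℕ.+ first p)
  S : Carrier
  S = ∑L (List.map (weight G ∘ entry) (families p s))
  s!≉0 : ¬ (ι (vfact s) ≈ 0#)
  s!≉0 = ι-nonZero ι-suc (vfact s) {{vfact-nonZero s}}
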